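{- Let $L$ and $N$ be finite sets, let $\varepsilon:L^{(2)}\to 2^N$ be a Fitch map with least-resolved tree $(T_\varepsilon,\lambda_\varepsilon)$, and let $T$ be a rooted phylogenetic tree with leaf set $L$. Then there exists an edge labeling $\lambda:E(T)\to 2^N$ such that $(T,\lambda)$ explains $\varepsilon$ if and only if $T$ is a refinement of $T_\varepsilon$.
   Context: $L^{(2)}=\{(x,y)\mid x,y\in L,\ x\ne y\}$. A rooted tree is phylogenetic if every inner vertex has at least two children. An edge-labeled tree $(T,\lambda)$ with leaf set $L$ and $\lambda:E(T)\to 2^N$ explains $\varepsilon:L^{(2)}\to 2^N$ if for all $(x,y)\in L^{(2)}$ and $k\in N$: $k\in\varepsilon(x,y)$ iff $k\in\lambda(e)$ for some edge $e$ on the path from $\operatorname{lca}_T(x,y)$ to $y$. $\varepsilon$ is a Fitch map if it is explained by some edge-labeled tree. For $y\in L$, $m\in N$ set $U_{\neg m}[y]=\{x\in L\setminus\{y\}\mid m\notin\varepsilon(x,y)\}\cup\{y\}$ and $\mathcal{N}_\varepsilon=\{U_{\neg m}[y]\mid y\in L, m\in N\}$. For a Fitch map, the least-resolved tree $(T_\varepsilon,\lambda_\varepsilon)$ is the tree with cluster set $\mathcal{H}(T_\varepsilon)=\mathcal{N}_\varepsilon\cup\{L\}\cup\{\{x\}\mid x\in L\}$ and labeling $\lambda_\varepsilon(\{\operatorname{parent}(v),v\})=\{m\in N\mid \exists y\in L: L(T_\varepsilon(v))=U_{\neg m}[y]\}$; it explains $\varepsilon$. Here $\mathcal{H}(T)=\{L(T(u))\mid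 u\in V(T)\}$ with $L(T(u))$ the leaves below $u$, and $T$ is a refinement of $T_\varepsilon$ iff $\mathcal{H}(T_\varepsilon)\subseteq\mathcal{H}(T)$. -}

module Defs where

open import Data.Nat using (ℕ; _≤_)
open import Data.Bool using (true; false; _∨_; not)
open import Data.Unit using (⊤; tt)
open import Data.Product using (Σ; ∃; _×_; _,_; proj₁; proj₂)
open import Data.Sum using (_⊎_)
open import Data.Fin using (Fin; _≟_)
open import Data.Fin.Subset using (Subset; _∈_; ⁅_⁆) renaming (⊤ to Full)
open import Data.Fin.Subset.Properties using (_∈?_)
open import Data.Vec using (tabulate)
open import Data.List using (List; []; _∷_; _++_; length; lookup; allFin)
open import Data.List.Relation.Unary.All using (All)
import Data.List.Membership.Propositional as LM
open import Data.List.Relation.Binary.Permutation.Propositional using (_↭_)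
open import Relation.Nullary using (¬_)
open import Relation.Nullary.Decidable using (⌊_⌋)
open import Relation.Binary.PropositionalEquality using (_≡_; _≢_)
open import Function.Bundles using (_⇔_)

-- Rooted trees with leaves drawn from L = Fin n; each child edge carries an
-- annotation of type A (⊤ for unlabeled trees, Subset m for edge-labeled ones).
data RTree (A : Set) (n : ℕ) : Set where
  leaf : Fin n → RTree A n
  node : List (A × RTree A n) → RTree A n

Tree : ℕ → Set
Tree n = RTree ⊤ n

LTree : ℕ → ℕ → Set
LTree m n = RTree (Subset m) n

module _ {A : Set} {n : ℕ} where
  mutual
    leafList : RTree A n → List (Fin n)
    leafList (leaf x) = x ∷ []
    leafList (node cs) = leafLists cs

    leafLists : List (A × RTree A n) → List (Fin n)
    leafLists [] = []
    leafLists ((_ , t) ∷ cs) = leafList t ++ leafLists cs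

  _∈L_ : Fin n → RTree A n → Set
  x ∈L t = x LM.∈ leafList t

  data Phylogenetic : RTree A n → Set where
    leaf : ∀ {x} → Phylogenetic (leaf x)
    node : ∀ {cs} → 2 ≤ length cs → All (λ c → Phylogenetic (proj₂ c)) cs →
           Phylogenetic (node cs)

  HasLeafSet : RTree A n → Set
  HasLeafSet t = leafList t ↭ allFin n

  -- v is (the subtree rooted at) a vertex of t
  data VertexOf : RTree A n → RTree A n → Set where
    root  : ∀ {t} → VertexOf t t
    child : ∀ {v cs} (i : Fin (length cs)) →
            VertexOf v (proj₂ (lookup cs i)) → VertexOf v (node cs)

  IsCluster : RTree A n → Subset n → Set
  IsCluster t C = Σ (RTree A n) λ v → VertexOf v t × (∀ x → (x ∈ C) ⇔ (x ∈L v))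

module _ {A : Set} {n : ℕ} where
  mutual
    erase : RTree A n → Tree n
    erase (leaf x) = leaf x
    erase (node cs) = node (eraseCs cs)

    eraseCs : List (A × RTree A n) → List (⊤ × Tree n)
    eraseCs [] = []
    eraseCs ((_ , t) ∷ cs) = (tt , erase t) ∷ eraseCs cs

module _ {m n : ℕ} where
  data OnRootPath : LTree m n → Fin n → Fin m → Set where
    here  : ∀ {cs y k} (j : Fin (length cs)) → y ∈L proj₂ (lookup cs j) →
            k ∈ proj₁ (lookup cs j) → OnRootPath (node cs) y k
    there : ∀ {cs y k} (j : Fin (length cs)) → y ∈L proj₂ (lookup cs j) →
            OnRootPath (proj₂ (lookup cs j)) y k → OnRootPath (node cs) y k

  -- k ∈ λ(e) for some edge e on the path from lca_t(x,y) to y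
  data OnLcaPath : LTree m n → Fin n → Fin n → Fin m → Set where
    split : ∀ {cs x y k} (i j : Fin (length cs)) → i ≢ j →
            x ∈L proj₂ (lookup cs i) → y ∈L proj₂ (lookup cs j) →
            OnRootPath (node cs) y k → OnLcaPath (node cs) x y k
    down  : ∀ {cs x y k} (i : Fin (length cs)) →
            x ∈L proj₂ (lookup cs i) → y ∈L proj₂ (lookup cs i) →
            OnLcaPath (proj₂ (lookup cs i)) x y k → OnLcaPath (node cs) x y k

  Explains : LTree m n → (Fin n → Fin n → Subset m) → Set
  Explains t ε = ∀ (x y : Fin n) → x ≢ y → ∀ (k : Fin m) →
                 (k ∈ ε x y) ⇔ OnLcaPath t x y k

  IsFitch : (Fin n → Fin n → Subset m) → Set
  IsFitch ε = Σ (LTree m n) λ t → Phylogenetic t × HasLeafSet t × Explains t ε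

  U¬ : (Fin n → Fin n → Subset m) → Fin n → Fin m → Subset n
  U¬ ε y k = tabulate λ x → ⌊ x ≟ y ⌋ ∨ not ⌊ k ∈? ε x y ⌋

  -- 𝓗(T_ε) = 𝓝_ε ∪ {L} ∪ {{x} | x ∈ L}
  InHε : (Fin n → Fin n → Subset m) → Subset n → Set
  InHε ε C = (∃ λ y → ∃ λ k → C ≡ U¬ ε y k) ⊎ (C ≡ Full) ⊎ (∃ λ x → C ≡ ⁅ x ⁆)

  RefinesLRT : Tree n → (Fin n → Fin n → Subset m) → Set
  RefinesLRT T ε = ∀ C → InHε ε C → IsCluster T C

{-# OPTIONS --safe #-}
-- In a tree explaining ε, U¬k[y] is the leaf set below the lowest edge carrying k on
-- the path from the root to y (all of L if there is none), so every tree explaining ε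
-- displays the clusters of T_ε.  Conversely, label each edge of a refinement T of T_ε
-- by the k for which the cluster below it is some U¬k[y'].  An edge carrying k then
-- lies between lca(x,y) and y iff y ∈ U¬k[y'] ∌ x for some y'; in any tree explaining
-- ε, that U¬k[y'] is the cluster below an edge carrying k, which thus lies between
-- lca(x,y) and y there as well, i.e. k ∈ ε(x,y).
module Submission where

open import Defs
open import Data.Nat using (ℕ)
open import Data.Bool as Bool using (Bool; T)
open import Data.Bool.Properties using (T-≡; T-∨)
open import Data.Empty using (⊥-elim)
open import Data.Fin using (Fin; zero; suc; _≟_)
open import Data.Fin.Properties using (any?)
open import Data.Fin.Subset using (Subset; _∈_)
open import Data.Fin.Subset.Properties using (_∈?_; ∈⊤; x∈⁅x⁆; x∈⁅y⁆⇒x≡y; ⊆-antisym)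
open import Data.List using (List; []; _∷_; _++_; length; lookup; allFin)
open import Data.List.Relation.Unary.Any using (here; there)
import Data.List.Relation.Unary.All as All
import Data.List.Relation.Unary.All.Properties as AllP
import Data.List.Membership.Propositional as List
import Data.List.Membership.DecPropositional as DecMembership
open import Data.List.Membership.Propositional.Properties using (∈-++⁻; ∈-++⁺ˡ; ∈-++⁺ʳ; ∈-allFin)
open import Data.List.Relation.Binary.Disjoint.Propositional using (Disjoint)
open import Data.List.Relation.Unary.Unique.Propositional using (Unique)
open import Data.List.Relation.Unary.AllPairs using ([]; _∷_)
open import Data.List.Relation.Unary.Unique.Propositional.Properties using (allFin⁺)
open import Data.List.Relation.Binary.Permutation.Propositional using (_↭_; ↭-sym; ↭⇒↭ₛ)
open import Data.List.Relation.Binary.Permutation.Propositional.Properties using (∈-resp-↭)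
import Data.List.Relation.Binary.Permutation.Setoid.Properties as Permutationₛ
open import Data.Product using (Σ; ∃; _×_; _,_; proj₁; proj₂)
open import Data.Sum using (_⊎_; inj₁; inj₂)
open import Data.Unit using (⊤; tt)
open import Data.Vec using (tabulate)
open import Data.Vec.Properties using (lookup∘tabulate; []=⇒lookup; lookup⇒[]=; ≡-dec)
open import Function using (_∘_)
open import Function.Bundles using (_⇔_; mk⇔; Equivalence)
open import Relation.Nullary using (¬_; Dec; yes; no)
open import Relation.Nullary.Decidable
  using (⌊_⌋; True; False; toWitness; fromWitness; toWitnessFalse; fromWitnessFalse)
open import Relation.Binary.PropositionalEquality
  using (_≡_; _≢_; refl; sym; trans; cong; cong₂; subst)
open import Relation.Binary.PropositionalEquality.Properties using (setoid)

open Equivalence using (to; from)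

Unique-++⁻ : ∀ {a} {A : Set a} (xs : List A) {ys} → Unique (xs ++ ys) →
             Unique xs × Unique ys × Disjoint xs ys
Unique-++⁻ []       u = [] , u , λ ()
Unique-++⁻ (x ∷ xs) (x∉ ∷ u) with Unique-++⁻ xs u
... | uxs , uys , disjoint = AllP.++⁻ˡ xs x∉ ∷ uxs , uys , disjoint′
  where
  disjoint′ : Disjoint (x ∷ xs) _
  disjoint′ (here refl , z∈ys) = All.lookup (AllP.++⁻ʳ xs x∉) z∈ys refl
  disjoint′ (there z∈xs , z∈ys) = disjoint (z∈xs , z∈ys)

module _ {n : ℕ} where

  Unique-resp-↭ : {xs ys : List (Fin n)} → xs ↭ ys → Unique xs → Unique ys
  Unique-resp-↭ p = Permutationₛ.Unique-resp-↭ (setoid (Fin n)) (↭⇒↭ₛ p)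

  ∈-tabulate : ∀ {f : Fin n → Bool} {x} → x ∈ tabulate f ⇔ T (f x)
  ∈-tabulate {f} {x} = mk⇔
    (λ p → from T-≡ (trans (sym (lookup∘tabulate f x)) ([]=⇒lookup p)))
    (λ t → lookup⇒[]= x (tabulate f) (trans (lookup∘tabulate f x) (to T-≡ t)))

  fromList : List (Fin n) → Subset n
  fromList xs = tabulate λ x → ⌊ DecMembership._∈?_ _≟_ x xs ⌋

  ∈-fromList : ∀ {xs x} → x ∈ fromList xs ⇔ x List.∈ xs
  ∈-fromList {xs} {x} = mk⇔
    (λ p → toWitness (to ∈-tabulate p))
    (λ p → from ∈-tabulate (fromWitness {a? = DecMembership._∈?_ _≟_ x xs} p))

  fromList-unique : ∀ {C xs} → (∀ x → x ∈ C ⇔ x List.∈ xs) → C ≡ fromList xs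
  fromList-unique C⇔xs =
    ⊆-antisym (λ p → from ∈-fromList (to (C⇔xs _) p)) (λ p → from (C⇔xs _) (to ∈-fromList p))

subtree : ∀ {A n} (cs : List (A × RTree A n)) → Fin (length cs) → RTree A n
subtree cs i = proj₂ (lookup cs i)

module _ {A : Set} {n : ℕ} where

  UniqueLeaves : RTree A n → Set
  UniqueLeaves t = Unique (leafList t)

  hasLeafSet⇒UniqueLeaves : ∀ {t : RTree A n} → HasLeafSet t → UniqueLeaves t
  hasLeafSet⇒UniqueLeaves h = Unique-resp-↭ (↭-sym h) (allFin⁺ n)

  hasLeafSet⇒∈L : ∀ {t : RTree A n} → HasLeafSet t → ∀ x → x ∈L t
  hasLeafSet⇒∈L h x = ∈-resp-↭ (↭-sym h) (∈-allFin x)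

  _∈L?_ : ∀ x (t : RTree A n) → Dec (x ∈L t)
  x ∈L? t = DecMembership._∈?_ _≟_ x (leafList t)

  ∈L-node⁻ : ∀ (cs : List (A × RTree A n)) {x} → x ∈L node cs → ∃ λ i → x ∈L subtree cs i
  ∈L-node⁻ ((_ , t) ∷ cs) p with ∈-++⁻ (leafList t) p
  ... | inj₁ q = zero , q
  ... | inj₂ q with ∈L-node⁻ cs q
  ...   | i , r = suc i , r

  ∈L-node⁺ : ∀ (cs : List (A × RTree A n)) i {x} → x ∈L subtree cs i → x ∈L node cs
  ∈L-node⁺ ((_ , t) ∷ cs) zero    p = ∈-++⁺ˡ p
  ∈L-node⁺ ((_ , t) ∷ cs) (suc i) p = ∈-++⁺ʳ (leafList t) (∈L-node⁺ cs i p)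

  UniqueLeaves-subtree : ∀ (cs : List (A × RTree A n)) i →
                         UniqueLeaves (node cs) → UniqueLeaves (subtree cs i)
  UniqueLeaves-subtree ((_ , t) ∷ cs) zero    u = proj₁ (Unique-++⁻ (leafList t) u)
  UniqueLeaves-subtree ((_ , t) ∷ cs) (suc i) u =
    UniqueLeaves-subtree cs i (proj₁ (proj₂ (Unique-++⁻ (leafList t) u)))

  subtree-unique : ∀ (cs : List (A × RTree A n)) → UniqueLeaves (node cs) → ∀ {i j x} →
                   x ∈L subtree cs i → x ∈L subtree cs j → i ≡ j
  subtree-unique ((_ , t) ∷ cs) u {zero}  {zero}  p q = refl
  subtree-unique ((_ , t) ∷ cs) u {zero}  {suc j} p q =
    ⊥-elim (proj₂ (proj₂ (Unique-++⁻ (leafList t) u)) (p , ∈L-node⁺ cs j q))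
  subtree-unique ((_ , t) ∷ cs) u {suc i} {zero}  p q =
    ⊥-elim (proj₂ (proj₂ (Unique-++⁻ (leafList t) u)) (q , ∈L-node⁺ cs i p))
  subtree-unique ((_ , t) ∷ cs) u {suc i} {suc j} p q =
    cong suc (subtree-unique cs (proj₁ (proj₂ (Unique-++⁻ (leafList t) u))) p q)

  vertexOf-∈L : ∀ {v t : RTree A n} {x} → VertexOf v t → x ∈L v → x ∈L t
  vertexOf-∈L root                   p = p
  vertexOf-∈L (child {cs = cs} i vt) p = ∈L-node⁺ cs i (vertexOf-∈L vt p)

  module _ (P : RTree A n → Set) (P-leaf : ∀ x → P (leaf x))
           (P-node : ∀ cs → (∀ i → P (subtree cs i)) → P (node cs)) where
    mutual
      RTree-ind : ∀ t → P t
      RTree-ind (leaf x)  = P-leaf x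
      RTree-ind (node cs) = P-node cs (subtrees-ind cs)

      subtrees-ind : ∀ cs i → P (subtree cs i)
      subtrees-ind ((_ , t) ∷ _) zero    = RTree-ind t
      subtrees-ind (_ ∷ cs)      (suc i) = subtrees-ind cs i

  leaf-vertexOf : ∀ t {x} → x ∈L t → VertexOf (leaf x) t
  leaf-vertexOf = RTree-ind (λ t → ∀ {x} → x ∈L t → VertexOf (leaf x) t)
    (λ { _ (here refl) → root })
    (λ cs ih p → let i , q = ∈L-node⁻ cs p in child i (ih i q))

  mutual
    leafList-erase : ∀ (t : RTree A n) → leafList (erase t) ≡ leafList t
    leafList-erase (leaf x)  = refl
    leafList-erase (node cs) = leafLists-eraseCs cs

    leafLists-eraseCs : ∀ (cs : List (A × RTree A n)) → leafLists (eraseCs cs) ≡ leafLists cs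
    leafLists-eraseCs []             = refl
    leafLists-eraseCs ((_ , t) ∷ cs) = cong₂ _++_ (leafList-erase t) (leafLists-eraseCs cs)

  ∈L-erase : ∀ (t : RTree A n) {x} → x ∈L erase t ⇔ x ∈L t
  ∈L-erase t {x} = mk⇔ (subst (x List.∈_) (leafList-erase t))
                         (subst (x List.∈_) (sym (leafList-erase t)))

  subtree-eraseCs : ∀ (cs : List (A × RTree A n)) i →
                    ∃ λ j → subtree (eraseCs cs) j ≡ erase (subtree cs i)
  subtree-eraseCs (_ ∷ cs) zero    = zero , refl
  subtree-eraseCs (_ ∷ cs) (suc i) = let j , e = subtree-eraseCs cs i in suc j , e

  vertexOf-erase : ∀ {v t : RTree A n} → VertexOf v t → VertexOf (erase v) (erase t)
  vertexOf-erase root = root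
  vertexOf-erase {v} (child {cs = cs} i vt) =
    let j , e = subtree-eraseCs cs i in child j (subst (VertexOf (erase v)) (sym e) (vertexOf-erase vt))

  isCluster-erase : ∀ {t : RTree A n} {C} → IsCluster t C → IsCluster (erase t) C
  isCluster-erase (v , vt , C⇔v) =
    erase v , vertexOf-erase vt ,
    λ x → mk⇔ (from (∈L-erase v) ∘ to (C⇔v x)) (from (C⇔v x) ∘ to (∈L-erase v))

module _ {m n : ℕ} where

  data Edge : LTree m n → Subset m → LTree m n → Set where
    here  : ∀ {cs} i → Edge (node cs) (proj₁ (lookup cs i)) (subtree cs i)
    there : ∀ {cs S v} i → Edge (subtree cs i) S v → Edge (node cs) S v

  Marked : LTree m n → Fin m → LTree m n → Set
  Marked t k v = ∃ λ S → Edge t S v × k ∈ S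

  edge-vertexOf : ∀ {t S v} → Edge t S v → VertexOf v t
  edge-vertexOf (here i)    = child i root
  edge-vertexOf (there i e) = child i (edge-vertexOf e)

  edge-subtree : ∀ {cs S v} → Edge (node cs) S v → ∃ λ i → VertexOf v (subtree cs i)
  edge-subtree (here i)    = i , root
  edge-subtree (there i e) = i , edge-vertexOf e

  edge-∈L : ∀ {t S v y} → Edge t S v → y ∈L v → y ∈L t
  edge-∈L e = vertexOf-∈L (edge-vertexOf e)

  marked-there : ∀ {cs k v} i → Marked (subtree cs i) k v → Marked (node cs) k v
  marked-there i (S , e , k∈S) = S , there i e , k∈S

  onRootPath⇒marked : ∀ {t y k} → OnRootPath t y k → ∃ λ v → Marked t k v × y ∈L v
  onRootPath⇒marked (here j yj k∈) = _ , (_ , here j , k∈) , yj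
  onRootPath⇒marked (there j yj r) =
    let v , mk , yv = onRootPath⇒marked r in v , marked-there j mk , yv

  edge⇒onRootPath : ∀ {t S v k y} → Edge t S v → k ∈ S → y ∈L v → OnRootPath t y k
  edge⇒onRootPath (here i)    k∈S yv = here i yv k∈S
  edge⇒onRootPath (there i e) k∈S yv = there i (edge-∈L e yv) (edge⇒onRootPath e k∈S yv)

  onLcaPath⇒onRootPath : ∀ {t : LTree m n} {x y k} → OnLcaPath t x y k → OnRootPath t y k
  onLcaPath⇒onRootPath (split _ _ _ _ _ r) = r
  onLcaPath⇒onRootPath (down i _ yi p)    = there i yi (onLcaPath⇒onRootPath p)

  edge⇒onLcaPath : ∀ {t S v k x y} → Edge t S v → k ∈ S → y ∈L v → x ∈L t → ¬ x ∈L v →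
                   OnLcaPath t x y k
  edge⇒onLcaPath {node cs} (here i) k∈S yv xt x∉v with ∈L-node⁻ cs xt
  ... | i′ , xi′ with i′ ≟ i
  ...   | yes refl = ⊥-elim (x∉v xi′)
  ...   | no i′≢i  = split i′ i i′≢i xi′ yv (here i yv k∈S)
  edge⇒onLcaPath {node cs} (there i e) k∈S yv xt x∉v with ∈L-node⁻ cs xt
  ... | i′ , xi′ with i′ ≟ i
  ...   | yes refl = down i xi′ (edge-∈L e yv) (edge⇒onLcaPath e k∈S yv xi′ x∉v)
  ...   | no i′≢i  = split i′ i i′≢i xi′ (edge-∈L e yv)
                       (there i (edge-∈L e yv) (edge⇒onRootPath e k∈S yv))

  onLcaPath⇒marked : ∀ {t : LTree m n} {x y k} → UniqueLeaves t → OnLcaPath t x y k →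
                     ∃ λ v → Marked t k v × y ∈L v × ¬ x ∈L v
  onLcaPath⇒marked u (split {cs} {x} i j i≢j xi yj r) with onRootPath⇒marked r
  ... | v , mk@(_ , e , _) , yv = v , mk , yv , x∉v
    where
    x∉v : ¬ x ∈L v
    x∉v xv with edge-subtree e
    ... | j′ , vj′ with subtree-unique cs u (vertexOf-∈L vj′ yv) yj
                      | subtree-unique cs u (vertexOf-∈L vj′ xv) xi
    ...   | refl | refl = i≢j refl
  onLcaPath⇒marked u (down {cs} i _ _ p) with onLcaPath⇒marked (UniqueLeaves-subtree cs i u) p
  ... | v , mk , yv , x∉v = v , marked-there i mk , yv , x∉v

  onLcaPath-restrict : ∀ {t v : LTree m n} {x y k} → UniqueLeaves t → VertexOf v t →
                       x ∈L v → y ∈L v → OnLcaPath t x y k → OnLcaPath v x y k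
  onLcaPath-restrict u root xv yv p = p
  onLcaPath-restrict u (child {cs = cs} i vi) xv yv (split i′ j′ i′≢j′ xi′ yj′ _)
    with subtree-unique cs u xi′ (vertexOf-∈L vi xv) | subtree-unique cs u yj′ (vertexOf-∈L vi yv)
  ... | refl | refl = ⊥-elim (i′≢j′ refl)
  onLcaPath-restrict u (child {cs = cs} i vi) xv yv (down i′ _ yi′ p)
    with subtree-unique cs u yi′ (vertexOf-∈L vi yv)
  ... | refl = onLcaPath-restrict (UniqueLeaves-subtree cs i u) vi xv yv p

  LowestMark : LTree m n → Fin n → Fin m → LTree m n → Set
  LowestMark t y k v = Marked t k v × y ∈L v × ¬ OnRootPath v y k

  lowestMark? : ∀ {t} y k → UniqueLeaves t → y ∈L t →
                ¬ OnRootPath t y k ⊎ ∃ (LowestMark t y k)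
  lowestMark? {t} y k = RTree-ind P (λ _ _ _ → inj₁ λ ()) step t
    where
    P : LTree m n → Set
    P t = UniqueLeaves t → y ∈L t → ¬ OnRootPath t y k ⊎ ∃ (LowestMark t y k)
    step : ∀ cs → (∀ i → P (subtree cs i)) → P (node cs)
    step cs ih u yt with ∈L-node⁻ cs yt
    ... | j , yj with ih j (UniqueLeaves-subtree cs j u) yj
    ...   | inj₂ (v , mk , yv , unmarked) = inj₂ (v , marked-there j mk , yv , unmarked)
    ...   | inj₁ unmarked with k ∈? proj₁ (lookup cs j)
    ...     | yes k∈S = inj₂ (_ , (_ , here j , k∈S) , yj , unmarked)
    ...     | no  k∉S = inj₁ unmarked-node
      where
      unmarked-node : ¬ OnRootPath (node cs) y k
      unmarked-node (here j′ yj′ k∈S) with subtree-unique cs u yj′ yj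
      ... | refl = k∉S k∈S
      unmarked-node (there j′ yj′ r) with subtree-unique cs u yj′ yj
      ... | refl = unmarked r

module _ {m n : ℕ} (ε : Fin n → Fin n → Subset m) where

  ∈-U¬⁺ : ∀ {y k x} → (x ≢ y → ¬ k ∈ ε x y) → x ∈ U¬ ε y k
  ∈-U¬⁺ {y} {k} {x} h = from ∈-tabulate (from (T-∨ {⌊ x ≟ y ⌋}) evidence)
    where
    evidence : True (x ≟ y) ⊎ False (k ∈? ε x y)
    evidence with x ≟ y
    ... | yes _   = inj₁ _
    ... | no  x≢y = inj₂ (fromWitnessFalse (h x≢y))

  ∈-U¬⁻ : ∀ {y k x} → x ∈ U¬ ε y k → x ≢ y → ¬ k ∈ ε x y
  ∈-U¬⁻ {y} {k} {x} x∈U x≢y with to (T-∨ {⌊ x ≟ y ⌋}) (to ∈-tabulate x∈U)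
  ... | inj₁ x≡y = ⊥-elim (x≢y (toWitness x≡y))
  ... | inj₂ k∉  = toWitnessFalse k∉

  U¬-self : ∀ {y k} → y ∈ U¬ ε y k
  U¬-self = ∈-U¬⁺ λ y≢y → ⊥-elim (y≢y refl)

  module _ {t : LTree m n} (leaves : HasLeafSet t) (explains : Explains t ε) where

    private
      unique : UniqueLeaves t
      unique = hasLeafSet⇒UniqueLeaves {t = t} leaves

      everywhere : ∀ x → x ∈L t
      everywhere = hasLeafSet⇒∈L {t = t} leaves

    U¬-cluster : ∀ y k → (∀ x → x ∈ U¬ ε y k) ⊎
                         ∃ λ v → Marked t k v × (∀ x → x ∈ U¬ ε y k ⇔ x ∈L v)
    U¬-cluster y k with lowestMark? y k unique (everywhere y)
    ... | inj₁ unmarked = inj₁ λ x → ∈-U¬⁺ λ x≢y k∈ →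
            unmarked (onLcaPath⇒onRootPath (to (explains x y x≢y k) k∈))
    ... | inj₂ (v , mk@(_ , e , k∈S) , yv , unmarked) =
      inj₂ (v , mk , λ x → mk⇔ (inside x) (outside x))
      where
      inside : ∀ x → x ∈ U¬ ε y k → x ∈L v
      inside x x∈U with x ∈L? v
      ... | yes xv  = xv
      ... | no  x∉v = ⊥-elim (∈-U¬⁻ x∈U x≢y
                        (from (explains x y x≢y k) (edge⇒onLcaPath e k∈S yv (everywhere x) x∉v)))
        where
        x≢y : x ≢ y
        x≢y refl = x∉v yv
      outside : ∀ x → x ∈L v → x ∈ U¬ ε y k
      outside x xv = ∈-U¬⁺ λ x≢y k∈ → unmarked (onLcaPath⇒onRootPath
        (onLcaPath-restrict unique (edge-vertexOf e) xv yv (to (explains x y x≢y k) k∈)))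

    explains⇒refines : RefinesLRT (erase t) ε
    explains⇒refines C C∈H = isCluster-erase (cluster C C∈H)
      where
      cluster : ∀ C → InHε ε C → IsCluster t C
      cluster _ (inj₁ (y , k , refl)) with U¬-cluster y k
      ... | inj₁ everything = t , root , λ x → mk⇔ (λ _ → everywhere x) (λ _ → everything x)
      ... | inj₂ (v , (_ , e , _) , U⇔v) = v , edge-vertexOf e , U⇔v
      cluster _ (inj₂ (inj₁ refl)) = t , root , λ x → mk⇔ (λ _ → everywhere x) (λ _ → ∈⊤)
      cluster _ (inj₂ (inj₂ (x , refl))) = leaf x , leaf-vertexOf t (everywhere x) , λ z →
        mk⇔ (λ z∈ → here (x∈⁅y⁆⇒x≡y x z∈)) (λ { (here refl) → x∈⁅x⁆ x })

    U¬-separation : ∀ {x y y′ k} → y ∈ U¬ ε y′ k → ¬ x ∈ U¬ ε y′ k → k ∈ ε x y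
    U¬-separation {x} {y} {y′} {k} y∈U x∉U with U¬-cluster y′ k
    ... | inj₁ everything = ⊥-elim (x∉U (everything x))
    ... | inj₂ (v , (_ , e , k∈S) , U⇔v) =
      from (explains x y x≢y k) (edge⇒onLcaPath e k∈S yv (everywhere x) x∉v)
      where
      yv : y ∈L v
      yv = to (U⇔v y) y∈U
      x∉v : ¬ x ∈L v
      x∉v = x∉U ∘ from (U⇔v x)
      x≢y : x ≢ y
      x≢y refl = x∉v yv

  U¬-equals? : ∀ k C → Dec (∃ λ y → U¬ ε y k ≡ C)
  U¬-equals? k C = any? λ y → ≡-dec Bool._≟_ (U¬ ε y k) C

  clusterLabel : List (Fin n) → Subset m
  clusterLabel ls = tabulate λ k → ⌊ U¬-equals? k (fromList ls) ⌋

  ∈-clusterLabel : ∀ {ls k} → k ∈ clusterLabel ls ⇔ ∃ λ y → U¬ ε y k ≡ fromList ls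
  ∈-clusterLabel {ls} {k} = mk⇔
    (λ k∈ → toWitness (to ∈-tabulate k∈))
    (λ U≡ → from ∈-tabulate (fromWitness {a? = U¬-equals? k (fromList ls)} U≡))

  mutual
    relabel : Tree n → LTree m n
    relabel (leaf x)  = leaf x
    relabel (node cs) = node (relabelCs cs)

    relabelCs : List (⊤ × Tree n) → List (Subset m × LTree m n)
    relabelCs []             = []
    relabelCs ((_ , t) ∷ cs) = (clusterLabel (leafList t) , relabel t) ∷ relabelCs cs

  mutual
    leafList-relabel : ∀ t → leafList (relabel t) ≡ leafList t
    leafList-relabel (leaf x)  = refl
    leafList-relabel (node cs) = leafLists-relabelCs cs

    leafLists-relabelCs : ∀ cs → leafLists (relabelCs cs) ≡ leafLists cs
    leafLists-relabelCs []             = refl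
    leafLists-relabelCs ((_ , t) ∷ cs) = cong₂ _++_ (leafList-relabel t) (leafLists-relabelCs cs)

  ∈L-relabel : ∀ t {x} → x ∈L relabel t ⇔ x ∈L t
  ∈L-relabel t {x} = mk⇔ (subst (x List.∈_) (leafList-relabel t))
                         (subst (x List.∈_) (sym (leafList-relabel t)))

  mutual
    erase-relabel : ∀ t → erase (relabel t) ≡ t
    erase-relabel (leaf x)  = refl
    erase-relabel (node cs) = cong node (eraseCs-relabelCs cs)

    eraseCs-relabelCs : ∀ cs → eraseCs (relabelCs cs) ≡ cs
    eraseCs-relabelCs []             = refl
    eraseCs-relabelCs ((_ , t) ∷ cs) = cong₂ _∷_ (cong (tt ,_) (erase-relabel t)) (eraseCs-relabelCs cs)

  lookup-relabelCs⁻ : ∀ cs j → ∃ λ i →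
    lookup (relabelCs cs) j ≡ (clusterLabel (leafList (subtree cs i)) , relabel (subtree cs i))
  lookup-relabelCs⁻ (_ ∷ cs) zero    = zero , refl
  lookup-relabelCs⁻ (_ ∷ cs) (suc j) = let i , e = lookup-relabelCs⁻ cs j in suc i , e

  lookup-relabelCs⁺ : ∀ cs i → ∃ λ j →
    lookup (relabelCs cs) j ≡ (clusterLabel (leafList (subtree cs i)) , relabel (subtree cs i))
  lookup-relabelCs⁺ (_ ∷ cs) zero    = zero , refl
  lookup-relabelCs⁺ (_ ∷ cs) (suc i) = let j , e = lookup-relabelCs⁺ cs i in suc j , e

  edge-relabel⁻ : ∀ T {S w} → Edge (relabel T) S w → S ≡ clusterLabel (leafList w)
  edge-relabel⁻ = RTree-ind P (λ _ ()) step
    where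
    P : Tree n → Set
    P T = ∀ {S w} → Edge (relabel T) S w → S ≡ clusterLabel (leafList w)
    step : ∀ cs → (∀ i → P (subtree cs i)) → P (node cs)
    step cs ih (here j) with lookup-relabelCs⁻ cs j
    ... | i , e = trans (cong proj₁ e) (cong clusterLabel (trans
                    (sym (leafList-relabel (subtree cs i))) (cong (leafList ∘ proj₂) (sym e))))
    step cs ih (there j e′) with lookup-relabelCs⁻ cs j
    ... | i , e = ih i (subst (λ c → Edge (proj₂ c) _ _) e e′)

  edge-relabel⁺ : ∀ {v T} → VertexOf v T →
                  v ≡ T ⊎ Edge (relabel T) (clusterLabel (leafList v)) (relabel v)
  edge-relabel⁺ root = inj₁ refl
  edge-relabel⁺ {v} (child {cs = cs} i vi) with lookup-relabelCs⁺ cs i | edge-relabel⁺ vi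
  ... | j , e | inj₁ refl = inj₂ (subst (λ c → Edge (node (relabelCs cs)) (proj₁ c) (proj₂ c)) e (here j))
  ... | j , e | inj₂ e′   = inj₂ (there j (subst (λ c → Edge (proj₂ c) _ (relabel v)) (sym e) e′))

  refines⇒explains : IsFitch ε → ∀ {T} → HasLeafSet T → RefinesLRT T ε → Explains (relabel T) ε
  refines⇒explains (t₀ , _ , leaves₀ , explains₀) {T} leaves refines x y x≢y k =
    mk⇔ separated separating
    where
    unique : UniqueLeaves (relabel T)
    unique = subst Unique (sym (leafList-relabel T)) (hasLeafSet⇒UniqueLeaves {t = T} leaves)
    separated : k ∈ ε x y → OnLcaPath (relabel T) x y k
    separated k∈ with refines (U¬ ε y k) (inj₁ (y , k , refl))
    ... | v , vT , U⇔v = separatedBelow (edge-relabel⁺ vT)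
      where
      yv : y ∈L v
      yv = to (U⇔v y) U¬-self
      x∉v : ¬ x ∈L v
      x∉v xv = ∈-U¬⁻ (from (U⇔v x) xv) x≢y k∈
      k∈label : k ∈ clusterLabel (leafList v)
      k∈label = from ∈-clusterLabel (y , fromList-unique U⇔v)
      xT : x ∈L T
      xT = hasLeafSet⇒∈L {t = T} leaves x
      separatedBelow : v ≡ T ⊎ Edge (relabel T) (clusterLabel (leafList v)) (relabel v) →
                       OnLcaPath (relabel T) x y k
      separatedBelow (inj₁ refl) = ⊥-elim (x∉v xT)
      separatedBelow (inj₂ e)    = edge⇒onLcaPath e k∈label (from (∈L-relabel v) yv)
                                     (from (∈L-relabel T) xT) (x∉v ∘ to (∈L-relabel v))
    separating : OnLcaPath (relabel T) x y k → k ∈ ε x y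
    separating p with onLcaPath⇒marked unique p
    ... | w , (_ , e , k∈S) , yw , x∉w with to ∈-clusterLabel (subst (k ∈_) (edge-relabel⁻ T e) k∈S)
    ...   | y′ , U≡w = U¬-separation {t = t₀} leaves₀ explains₀ y∈U x∉U
      where
      y∈U : y ∈ U¬ ε y′ k
      y∈U = subst (y ∈_) (sym U≡w) (from ∈-fromList yw)
      x∉U : ¬ x ∈ U¬ ε y′ k
      x∉U x∈U = x∉w (to ∈-fromList (subst (x ∈_) U≡w x∈U))

-- Neither T nor the tree witnessing that ε is a Fitch map needs to be phylogenetic.
lemma3 : ∀ {n m : ℕ} (ε : Fin n → Fin n → Subset m) → IsFitch ε →
    (T : Tree n) → Phylogenetic T → HasLeafSet T →
    (Σ (LTree m n) (λ Tλ → (erase Tλ ≡ T) × Explains Tλ ε)) ⇔ RefinesLRT T ε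
lemma3 ε fitch T _ leaves = mk⇔
  (λ { (Tλ , refl , explains) →
         explains⇒refines ε (subst (_↭ allFin _) (leafList-erase Tλ) leaves) explains })
  (λ refines → relabel ε T , erase-relabel ε T , refines⇒explains ε fitch leaves refines)
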